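{- Let $n\ge 3$ and let $L^B$ be a blow-up of the Boolean lattice $L\cong\mathbf{2}^n$. Then the independence number of $G^c(L^B)_{SR}$ is $\beta(G^c(L^B)_{SR})=2^{n-1}-1$.
   Context: Blow-up: let $L=\mathbf{2}^n$. A blow-up $L^B$ is obtained by replacing each $a\in L\setminus\{0,1\}$ by a finite nonempty chain $C_a$ (possibly a single element), keeping $0,1$; order: $x\le y$ iff $x=0$, or $y=1$, or $x,y$ lie in the same chain $C_a$ with $x\le y$ there, or $x\in C_a$, $y\in C_b$ with $a<b$ in $L$; this is a lattice. For a lattice $M$ with $0$: $Z^*(M)$ is the set of nonzero $a$ with $a\wedge b=0$ for some $b\ne0$; $G^c(M)$ is the graph on $Z^*(M)$ with distinct $a,b$ adjacent iff $a\wedge b\neq 0$. In a connected graph $G$, $u$ is maximally distant from $v$ if $d(v,w)\le d(u,v)$ for every neighbor $w$ of $u$; $u,v$ are mutually maximally distant if each is maximally distant from the other; $\partial(G)$ is the set of vertices mutually maximally distant from some vertex; the strong resolving graph $G_{SR}$ has vertex set $\partial(G)$ with distinct $u,v$ adjacent iff mutually maximally distant in $G$. $\beta(G)$ is the maximum size of a set of pairwise non-adjacent vertices. -}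

module Defs where

open import Data.Nat using (ℕ; zero; suc; _≤_)
open import Data.Bool using (Bool; true; false; _∧_; not; T)
open import Data.Fin using (Fin; toℕ)
open import Data.Fin.Subset using (Subset; _⊂_)
open import Data.Vec using (Vec; []; _∷_)
open import Data.List using (List; length)
open import Data.List.Relation.Unary.All using (All)
open import Data.List.Relation.Unary.AllPairs using (AllPairs)
open import Data.List.Relation.Unary.Unique.Propositional using (Unique)
open import Data.Product using (Σ; _×_; ∃)
open import Data.Sum using (_⊎_)
open import Data.Unit using (⊤)
open import Data.Empty using (⊥)
open import Relation.Nullary using (¬_)
open import Relation.Binary.PropositionalEquality using (_≡_; _≢_)

-- The Boolean lattice L = 2^n is  Subset n  (Vec Bool n) ordered by ⊆.

isBot : ∀ {n} → Subset n → Bool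
isBot []      = true
isBot (b ∷ a) = not b ∧ isBot a

isTop : ∀ {n} → Subset n → Bool
isTop []      = true
isTop (b ∷ a) = b ∧ isTop a

nontrivial : ∀ {n} → Subset n → Bool
nontrivial a = not (isBot a) ∧ not (isTop a)

-- The parameter  sz : Subset n → ℕ  describes the chains:
-- the chain C_a replacing a ∈ L∖{0,1} is  Fin (suc (sz a))  (a finite
-- nonempty chain, ordered as usual).  Values of sz at 0,1 are irrelevant.

data BlowUp (n : ℕ) (sz : Subset n → ℕ) : Set where
  bot : BlowUp n sz
  top : BlowUp n sz
  mid : (a : Subset n) → T (nontrivial a) → Fin (suc (sz a)) → BlowUp n sz

module _ {n : ℕ} {sz : Subset n → ℕ} where

  _≤B_ : BlowUp n sz → BlowUp n sz → Set
  bot       ≤B _         = ⊤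
  top       ≤B bot       = ⊥
  top       ≤B top       = ⊤
  top       ≤B mid _ _ _ = ⊥
  mid _ _ _ ≤B bot       = ⊥
  mid _ _ _ ≤B top       = ⊤
  mid a _ i ≤B mid b _ j = (Σ (a ≡ b) λ _ → toℕ i ≤ toℕ j) ⊎ (a ⊂ b)

  MeetZero : BlowUp n sz → BlowUp n sz → Set
  MeetZero x y = ∀ z → z ≤B x → z ≤B y → z ≡ bot

  Zstar : BlowUp n sz → Set
  Zstar x = x ≢ bot × ∃ λ y → y ≢ bot × MeetZero x y

  Adj : BlowUp n sz → BlowUp n sz → Set
  Adj x y = x ≢ y × Zstar x × Zstar y × ¬ MeetZero x y

  data Walk : BlowUp n sz → BlowUp n sz → ℕ → Set where
    here : ∀ {x} → Zstar x → Walk x x zero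
    step : ∀ {x y z k} → Adj x y → Walk y z k → Walk x z (suc k)

  Dist : BlowUp n sz → BlowUp n sz → ℕ → Set
  Dist x y k = Walk x y k × (∀ m → Walk x y m → k ≤ m)

  MaxDist : BlowUp n sz → BlowUp n sz → Set
  MaxDist u v = ∀ w → Adj u w → ∀ k l → Dist v w k → Dist u v l → k ≤ l

  MMD : BlowUp n sz → BlowUp n sz → Set
  MMD u v = Zstar u × Zstar v × MaxDist u v × MaxDist v u

  InBoundary : BlowUp n sz → Set
  InBoundary u = ∃ λ v → MMD u v

  AdjSR : BlowUp n sz → BlowUp n sz → Set
  AdjSR u v = u ≢ v × MMD u v

  IndependentSR : List (BlowUp n sz) → Set
  IndependentSR S = Unique S × All InBoundary S × AllPairs (λ u v → ¬ AdjSR u v) S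

  IndependenceNumberSR : ℕ → Set
  IndependenceNumberSR k =
    (Σ (List (BlowUp n sz)) λ S → IndependentSR S × length S ≡ k)
    × (∀ S → IndependentSR S → length S ≤ k)

-- Z*(L^B) is L^B without 0 and 1, and two of its elements are adjacent in G^c(L^B) exactly when
-- their supports (the a ∈ 2^n whose chain C_a contains them) meet; for n ≥ 3 two vertices with
-- disjoint supports have a common neighbour in the chain of a two-element set, so the diameter is 2.
-- Distinct vertices are then mutually maximally distant iff their supports are equal or disjoint:
-- if x lies in the support of u but not of v while the supports meet, the atom of x is a neighbour
-- of u at distance 2 from v, although d(u,v) = 1. Hence an independent set of G^c(L^B)_SR has at
-- most one vertex with support in each pair {a, ∁ a} and none for {∅, 2^n}, so at most 2^(n-1) - 1
-- vertices; the bottoms of the chains of the nontrivial supports containing a fixed point form an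
-- independent set of exactly that size.

module Submission where

open import Defs
open import Data.Nat using (ℕ; zero; suc; _+_; _≤_; _^_; _∸_; z≤n; s≤s)
open import Data.Nat.Properties
  using (_≤?_; ≤-refl; ≤-trans; m≤n⇒m≤1+n; ∸-monoˡ-≤; +-∸-assoc; +-identityʳ; m^n>0; module ≤-Reasoning)
open import Data.Bool using (not; T)
open import Data.Bool.Properties using (T-∧) renaming (_≟_ to _≟ᵇ_)
open import Data.Fin using (Fin) renaming (zero to 0F; suc to 1+)
open import Data.Fin.Subset
open import Data.Fin.Subset.Properties
open import Data.Vec using ([]; _∷_; here; there)
open import Data.Vec.Properties using (≡-dec; ∷-injectiveʳ)
open import Data.List using (List; []; _∷_; [_]; length; map; _++_)
open import Data.List.Properties using (length-map; length-++; length-removeAt′)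
open import Data.List.Membership.Propositional using () renaming (_∈_ to _∈ᴸ_; _─_ to _─ᴸ_)
open import Data.List.Membership.Propositional.Properties using (∈-map⁺; ∈-++⁺ˡ; ∈-++⁺ʳ)
open import Data.List.Relation.Binary.Subset.Propositional using () renaming (_⊆_ to _⊆ᴸ_)
open import Data.List.Relation.Unary.Any using (index; here; there)
open import Data.List.Relation.Unary.All using (All; []; _∷_)
import Data.List.Relation.Unary.All as All
import Data.List.Relation.Unary.All.Properties as All
open import Data.List.Relation.Unary.AllPairs using (AllPairs; []; _∷_)
import Data.List.Relation.Unary.AllPairs as AllPairs
import Data.List.Relation.Unary.AllPairs.Properties as AllPairs
open import Data.List.Relation.Unary.Unique.Propositional using (Unique)
open import Data.Product using (_×_; _,_; ∃; proj₁; proj₂)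
open import Data.Sum using (_⊎_; inj₁; inj₂; [_,_]′)
open import Data.Unit using (tt)
open import Function using (_∘_; id)
open import Function.Bundles using (Equivalence)
open import Relation.Nullary using (¬_; yes; no; contradiction)
open import Relation.Nullary.Decidable using (decidable-stable)
open import Relation.Binary.PropositionalEquality
  using (_≡_; _≢_; refl; sym; trans; cong; cong₂; subst; ≢-sym; module ≡-Reasoning)
import Algebra.Lattice.Properties.BooleanAlgebra as BooleanAlgebraProperties

private variable
  n : ℕ
  a b : Subset n
  x y z : Fin n

∈⇒¬isBot : x ∈ a → T (not (isBot a))
∈⇒¬isBot here = tt
∈⇒¬isBot {a = inside ∷ _} (there _) = tt
∈⇒¬isBot {a = outside ∷ _} (there x∈a) = ∈⇒¬isBot x∈a

∉⇒¬isTop : x ∉ a → T (not (isTop a))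
∉⇒¬isTop {x = 0F} {a = outside ∷ _} _ = tt
∉⇒¬isTop {x = 0F} {a = inside ∷ _} x∉a = contradiction here x∉a
∉⇒¬isTop {x = 1+ _} {a = outside ∷ _} _ = tt
∉⇒¬isTop {x = 1+ _} {a = inside ∷ _} x∉a = ∉⇒¬isTop (x∉a ∘ there)

¬isBot⇒Nonempty : (a : Subset n) → T (not (isBot a)) → Nonempty a
¬isBot⇒Nonempty (inside ∷ _) _ = 0F , here
¬isBot⇒Nonempty (outside ∷ a) ¬bot = let (x , x∈a) = ¬isBot⇒Nonempty a ¬bot in 1+ x , there x∈a

¬isTop⇒∃∉ : (a : Subset n) → T (not (isTop a)) → ∃ (_∉ a)
¬isTop⇒∃∉ (outside ∷ _) _ = 0F , λ ()
¬isTop⇒∃∉ (inside ∷ a) ¬top = let (x , x∉a) = ¬isTop⇒∃∉ a ¬top in 1+ x , x∉a ∘ drop-there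

nontrivial⁺ : x ∈ a → y ∉ a → T (nontrivial a)
nontrivial⁺ x∈a y∉a = Equivalence.from T-∧ (∈⇒¬isBot x∈a , ∉⇒¬isTop y∉a)

nontrivial⁻ : (a : Subset n) → T (nontrivial a) → Nonempty a × ∃ (_∉ a)
nontrivial⁻ a p = let (¬bot , ¬top) = Equivalence.to T-∧ p in ¬isBot⇒Nonempty a ¬bot , ¬isTop⇒∃∉ a ¬top

∁-nontrivial : (a : Subset n) → T (nontrivial a) → T (nontrivial (∁ a))
∁-nontrivial a p = let ((x , x∈a) , (y , y∉a)) = nontrivial⁻ a p in nontrivial⁺ (x∉p⇒x∈∁p y∉a) (x∈p⇒x∉∁p x∈a)

⁅⁆-nontrivial : y ≢ x → T (nontrivial ⁅ x ⁆)
⁅⁆-nontrivial y≢x = nontrivial⁺ (x∈⁅x⁆ _) (x≢y⇒x∉⁅y⁆ y≢x)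

⁅⁆⊆ : x ∈ a → ⁅ x ⁆ ⊆ a
⁅⁆⊆ {x = x} {a} x∈a y∈⁅x⁆ = subst (_∈ a) (sym (x∈⁅y⁆⇒x≡y x y∈⁅x⁆)) x∈a

⁅⁆∪⁅⁆-nontrivial : z ≢ x → z ≢ y → T (nontrivial (⁅ x ⁆ ∪ ⁅ y ⁆))
⁅⁆∪⁅⁆-nontrivial {x = x} {y = y} z≢x z≢y =
  nontrivial⁺ (x∈p∪q⁺ (inj₁ (x∈⁅x⁆ x))) λ z∈x∪y →
    [ z≢x ∘ x∈⁅y⁆⇒x≡y x , z≢y ∘ x∈⁅y⁆⇒x≡y y ]′ (x∈p∪q⁻ ⁅ x ⁆ ⁅ y ⁆ z∈x∪y)

⊆⇒≡⊎⊂ : a ⊆ b → a ≡ b ⊎ a ⊂ b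
⊆⇒≡⊎⊂ {a = a} {b} a⊆b with a ⊂? b
... | yes a⊂b = inj₂ a⊂b
... | no a⊄b = inj₁ (⊆-antisym a⊆b b⊆a)
  where
  b⊆a : b ⊆ a
  b⊆a {x} x∈b = decidable-stable (x ∈? a) λ x∉a → a⊄b (a⊆b , x , x∈b , x∉a)

≢⇒distinguishing : (a b : Subset n) → a ≢ b → ∃ λ x → x ∈ a × x ∉ b ⊎ x ∈ b × x ∉ a
≢⇒distinguishing a b a≢b with ⊆⇒≡⊎⊂ (p∩q⊆p a b)
... | inj₂ (_ , x , x∈a , x∉a∩b) = x , inj₁ (x∈a , λ x∈b → x∉a∩b (x∈p∩q⁺ (x∈a , x∈b)))
... | inj₁ a∩b≡a with ⊆⇒≡⊎⊂ (λ x∈a → p∩q⊆q a b (subst (_ ∈_) (sym a∩b≡a) x∈a))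
...   | inj₁ a≡b = contradiction a≡b a≢b
...   | inj₂ (_ , x , x∈b , x∉a) = x , inj₂ (x∈b , x∉a)

∩∁-Empty : (a : Subset n) → Empty (a ∩ ∁ a)
∩∁-Empty a (x , x∈a∩∁a) = ∉⊥ (subst (x ∈_) (∩-inverseʳ a) x∈a∩∁a)

∁-involutive : (a : Subset n) → ∁ (∁ a) ≡ a
∁-involutive {n} = BooleanAlgebraProperties.¬-involutive (∪-∩-booleanAlgebra n)

∁-injective : ∁ a ≡ ∁ b → a ≡ b
∁-injective {a = a} {b} ∁a≡∁b = trans (sym (∁-involutive a)) (trans (cong ∁ ∁a≡∁b) (∁-involutive b))

∩-comm-Nonempty : Nonempty (a ∩ b) → Nonempty (b ∩ a)
∩-comm-Nonempty {a = a} {b} = subst Nonempty (∩-comm a b)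

thirdPoint : 3 ≤ n → (x y : Fin n) → ∃ λ z → z ≢ x × z ≢ y
thirdPoint (s≤s (s≤s (s≤s _))) = λ where
  0F          0F          → 1+ 0F , (λ ()) , (λ ())
  0F          (1+ 0F)     → 1+ (1+ 0F) , (λ ()) , (λ ())
  0F          (1+ (1+ _)) → 1+ 0F , (λ ()) , (λ ())
  (1+ 0F)     0F          → 1+ (1+ 0F) , (λ ()) , (λ ())
  (1+ 0F)     (1+ _)      → 0F , (λ ()) , (λ ())
  (1+ (1+ _)) 0F          → 1+ 0F , (λ ()) , (λ ())
  (1+ (1+ _)) (1+ _)      → 0F , (λ ()) , (λ ())

-- The pair {a, ∁ a}, represented by its member not containing 0, with that coordinate dropped.
complementClass : Subset (suc n) → Subset n
complementClass (inside ∷ t) = ∁ t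
complementClass (outside ∷ t) = t

complementClass-≡ : {a b : Subset (suc n)} → complementClass a ≡ complementClass b → a ≡ b ⊎ ∁ a ≡ b
complementClass-≡ {a = inside ∷ t} {inside ∷ s} ∁t≡∁s = inj₁ (cong (inside ∷_) (∁-injective ∁t≡∁s))
complementClass-≡ {a = outside ∷ t} {outside ∷ s} t≡s = inj₁ (cong (outside ∷_) t≡s)
complementClass-≡ {a = inside ∷ t} {outside ∷ s} ∁t≡s = inj₂ (cong (outside ∷_) ∁t≡s)
complementClass-≡ {a = outside ∷ t} {inside ∷ s} t≡∁s = inj₂ (cong (inside ∷_) (trans (cong ∁ t≡∁s) (∁-involutive s)))

complementClass≢⊥ : (a : Subset (suc n)) → T (nontrivial a) → complementClass a ≢ ⊥
complementClass≢⊥ (outside ∷ t) p t≡⊥ with proj₁ (nontrivial⁻ (outside ∷ t) p)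
... | 1+ x , there x∈t = ∉⊥ (subst (x ∈_) t≡⊥ x∈t)
complementClass≢⊥ (inside ∷ t) p ∁t≡⊥ with proj₂ (nontrivial⁻ (inside ∷ t) p)
... | 0F , 0∉a = 0∉a here
... | 1+ x , x+1∉a = ∉⊥ (subst (x ∈_) ∁t≡⊥ (x∉p⇒x∈∁p (x+1∉a ∘ there)))

module _ {A : Set} where

  ∈-─⁺ : ∀ {x y : A} {ys} (x∈ys : x ∈ᴸ ys) → y ∈ᴸ ys → y ≢ x → y ∈ᴸ ys ─ᴸ x∈ys
  ∈-─⁺ (here refl) (here refl) y≢x = contradiction refl y≢x
  ∈-─⁺ (here _) (there y∈ys) _ = y∈ys
  ∈-─⁺ (there _) (here y≡z) _ = here y≡z
  ∈-─⁺ (there x∈ys) (there y∈ys) y≢x = there (∈-─⁺ x∈ys y∈ys y≢x)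

  unique-⊆⇒length≤ : {xs ys : List A} → Unique xs → xs ⊆ᴸ ys → length xs ≤ length ys
  unique-⊆⇒length≤ [] _ = z≤n
  unique-⊆⇒length≤ {x ∷ xs} {ys} (x∉xs ∷ xs!) x∷xs⊆ys = begin
    suc (length xs)            ≤⟨ s≤s (unique-⊆⇒length≤ xs! xs⊆ys─x) ⟩
    suc (length (ys ─ᴸ x∈ys))  ≡⟨ length-removeAt′ ys (index x∈ys) ⟨
    length ys                  ∎
    where
    open ≤-Reasoning
    x∈ys = x∷xs⊆ys (here refl)
    xs⊆ys─x : xs ⊆ᴸ ys ─ᴸ x∈ys
    xs⊆ys─x y∈xs = ∈-─⁺ x∈ys (x∷xs⊆ys (there y∈xs)) (≢-sym (All.lookup x∉xs y∈xs))

  AllPairs-mapWithin : ∀ {P : A → Set} {R S : A → A → Set} → (∀ {x y} → P x → P y → R x y → S x y) →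
                       ∀ {xs} → All P xs → AllPairs R xs → AllPairs S xs
  AllPairs-mapWithin f [] [] = []
  AllPairs-mapWithin f (px ∷ pxs) (rx ∷ rxs) =
    All.zipWith (λ (py , r) → f px py r) (pxs , rx) ∷ AllPairs-mapWithin f pxs rxs

allSubsets : ∀ m → List (Subset m)
allSubsets zero = [ [] ]
allSubsets (suc m) = map (outside ∷_) (allSubsets m) ++ map (inside ∷_) (allSubsets m)

∈-allSubsets : (a : Subset n) → a ∈ᴸ allSubsets n
∈-allSubsets [] = here refl
∈-allSubsets {suc n} (outside ∷ a) = ∈-++⁺ˡ (∈-map⁺ (outside ∷_) (∈-allSubsets a))
∈-allSubsets {suc n} (inside ∷ a) =
  ∈-++⁺ʳ (map (outside ∷_) (allSubsets n)) (∈-map⁺ (inside ∷_) (∈-allSubsets a))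

length-allSubsets : ∀ m → length (allSubsets m) ≡ 2 ^ m
length-allSubsets zero = refl
length-allSubsets (suc m) = begin
  length (map (outside ∷_) subsets ++ map (inside ∷_) subsets)  ≡⟨ length-++ (map (outside ∷_) subsets) ⟩
  length (map (outside ∷_) subsets) + length (map (inside ∷_) subsets)
    ≡⟨ cong₂ _+_ (length-map (outside ∷_) subsets) (length-map (inside ∷_) subsets) ⟩
  length subsets + length subsets  ≡⟨ cong (λ k → k + k) (length-allSubsets m) ⟩
  2 ^ m + 2 ^ m                    ≡⟨ cong (2 ^ m +_) (+-identityʳ (2 ^ m)) ⟨
  2 ^ suc m                        ∎
  where
  open ≡-Reasoning
  subsets = allSubsets m

allSubsets-unique : ∀ m → Unique (allSubsets m)
allSubsets-unique zero = [] ∷ []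
allSubsets-unique (suc m) = AllPairs.++⁺
  (AllPairs.map⁺ (AllPairs.map (_∘ ∷-injectiveʳ) (allSubsets-unique m)))
  (AllPairs.map⁺ (AllPairs.map (_∘ ∷-injectiveʳ) (allSubsets-unique m)))
  (All.map⁺ (All.universal (λ _ → All.map⁺ (All.universal (λ _ ()) _)) _))

nontrivialContaining0 : ∀ m → List (∃ λ (t : Subset m) → T (nontrivial (inside ∷ t)))
nontrivialContaining0 zero = []
nontrivialContaining0 (suc m) =
  map (λ t → outside ∷ t , tt) (allSubsets m) ++ map (λ (t , p) → inside ∷ t , p) (nontrivialContaining0 m)

length-nontrivialContaining0 : ∀ m → length (nontrivialContaining0 m) ≡ 2 ^ m ∸ 1
length-nontrivialContaining0 zero = refl
length-nontrivialContaining0 (suc m) = begin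
  length (map _ subsets ++ map _ rest)          ≡⟨ length-++ (map _ subsets) ⟩
  length (map _ subsets) + length (map _ rest)  ≡⟨ cong₂ _+_ (length-map _ subsets) (length-map _ rest) ⟩
  length subsets + length rest                  ≡⟨ cong₂ _+_ (length-allSubsets m) (length-nontrivialContaining0 m) ⟩
  2 ^ m + (2 ^ m ∸ 1)                           ≡⟨ +-∸-assoc (2 ^ m) (m^n>0 2 m) ⟨
  (2 ^ m + 2 ^ m) ∸ 1                           ≡⟨ cong (λ k → (2 ^ m + k) ∸ 1) (+-identityʳ (2 ^ m)) ⟨
  2 ^ suc m ∸ 1                                 ∎
  where
  open ≡-Reasoning
  subsets = allSubsets m
  rest = nontrivialContaining0 m

nontrivialContaining0-unique : ∀ m → AllPairs (λ (t , _) (s , _) → t ≢ s) (nontrivialContaining0 m)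
nontrivialContaining0-unique zero = []
nontrivialContaining0-unique (suc m) = AllPairs.++⁺
  (AllPairs.map⁺ (AllPairs.map (_∘ ∷-injectiveʳ) (allSubsets-unique m)))
  (AllPairs.map⁺ (AllPairs.map (_∘ ∷-injectiveʳ) (nontrivialContaining0-unique m)))
  (All.map⁺ (All.universal (λ _ → All.map⁺ (All.universal (λ _ ()) _)) _))

module _ {n : ℕ} {sz : Subset n → ℕ} where

  private variable
    u v : BlowUp n sz
    l : ℕ
    c : Subset n

  -- u lies in the chain C_(support u); the junk values at bot and top make ≤B monotone into ⊆.
  support : BlowUp n sz → Subset n
  support bot = ⊥
  support top = ⊤
  support (mid a _ _) = a

  chainBottom : (c : Subset n) → T (nontrivial c) → BlowUp n sz
  chainBottom c r = mid c r 0F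

  ≤B-refl : (u : BlowUp n sz) → u ≤B u
  ≤B-refl bot = tt
  ≤B-refl top = tt
  ≤B-refl (mid _ _ _) = inj₁ (refl , ≤-refl)

  ≤B-top : (u : BlowUp n sz) → u ≤B top
  ≤B-top bot = tt
  ≤B-top top = tt
  ≤B-top (mid _ _ _) = tt

  ≤B⇒support⊆ : u ≤B v → support u ⊆ support v
  ≤B⇒support⊆ {bot} _ x∈⊥ = contradiction x∈⊥ ∉⊥
  ≤B⇒support⊆ {top} {top} _ = id
  ≤B⇒support⊆ {mid _ _ _} {top} _ _ = ∈⊤
  ≤B⇒support⊆ {mid _ _ _} {mid _ _ _} (inj₁ (refl , _)) = id
  ≤B⇒support⊆ {mid _ _ _} {mid _ _ _} (inj₂ (a⊆b , _)) = a⊆b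

  chainBottom-≤B : ∀ {r} → c ⊆ support u → chainBottom c r ≤B u
  chainBottom-≤B {c} {bot} {r} c⊆⊥ = let (x , x∈c) = proj₁ (nontrivial⁻ c r) in contradiction (c⊆⊥ x∈c) ∉⊥
  chainBottom-≤B {u = top} _ = tt
  chainBottom-≤B {u = mid _ _ _} c⊆a with ⊆⇒≡⊎⊂ c⊆a
  ... | inj₁ refl = inj₁ (refl , z≤n)
  ... | inj₂ c⊂a = inj₂ c⊂a

  disjoint⇒MeetZero : u ≢ top → Empty (support u ∩ support v) → MeetZero u v
  disjoint⇒MeetZero {u = top} u≢top _ _ _ _ = contradiction refl u≢top
  disjoint⇒MeetZero _ _ bot _ _ = refl
  disjoint⇒MeetZero {u = bot} _ _ top () _
  disjoint⇒MeetZero {u = mid _ _ _} _ _ top () _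
  disjoint⇒MeetZero _ disjoint (mid c r _) z≤u z≤v =
    let (x , x∈c) = proj₁ (nontrivial⁻ c r)
    in contradiction (x , x∈p∩q⁺ (≤B⇒support⊆ z≤u x∈c , ≤B⇒support⊆ z≤v x∈c)) disjoint

  Zstar⇒≢top : Zstar u → u ≢ top
  Zstar⇒≢top (_ , y , y≢bot , meetZero) refl = y≢bot (meetZero y (≤B-top y) (≤B-refl y))

  Zstar⁺ : u ≢ bot → u ≢ top → Zstar u
  Zstar⁺ {bot} u≢bot _ = contradiction refl u≢bot
  Zstar⁺ {top} _ u≢top = contradiction refl u≢top
  Zstar⁺ {mid a p _} _ _ =
    (λ ()) , chainBottom (∁ a) (∁-nontrivial a p) , (λ ()) , disjoint⇒MeetZero (λ ()) (∩∁-Empty a)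

  Zstar⇒nontrivial : Zstar u → T (nontrivial (support u))
  Zstar⇒nontrivial {bot} (u≢bot , _) = contradiction refl u≢bot
  Zstar⇒nontrivial {top} u* = contradiction refl (Zstar⇒≢top u*)
  Zstar⇒nontrivial {mid _ p _} _ = p

  Zstar⇒Nonempty : Zstar u → Nonempty (support u)
  Zstar⇒Nonempty u* = proj₁ (nontrivial⁻ _ (Zstar⇒nontrivial u*))

  Adj⇒meets : Adj u v → Nonempty (support u ∩ support v)
  Adj⇒meets (_ , u* , _ , ¬meetZero) =
    decidable-stable (nonempty? _) λ disjoint → ¬meetZero (disjoint⇒MeetZero (Zstar⇒≢top u*) disjoint)

  Walk0⇒≡ : Walk u v 0 → u ≡ v
  Walk0⇒≡ (here _) = refl

  Walk1⇒Adj : Walk u v 1 → Adj u v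
  Walk1⇒Adj (step adj (here _)) = adj

  Adj⇒Dist1 : Adj u v → Dist u v 1
  Adj⇒Dist1 adj@(u≢v , _ , v* , _) = step adj (here v*) , λ where
    zero walk → contradiction (Walk0⇒≡ walk) u≢v
    (suc _) _ → s≤s z≤n

  Dist≥1 : u ≢ v → Dist u v l → 1 ≤ l
  Dist≥1 {l = zero} u≢v (walk , _) = contradiction (Walk0⇒≡ walk) u≢v
  Dist≥1 {l = suc _} _ _ = s≤s z≤n

module _ {n : ℕ} {sz : Subset n → ℕ} (n≥3 : 3 ≤ n) where

  private variable
    u v : BlowUp n sz
    k : ℕ

  atom : Fin n → BlowUp n sz
  atom x = chainBottom ⁅ x ⁆ (⁅⁆-nontrivial (proj₁ (proj₂ (thirdPoint n≥3 x x))))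

  meets⇒¬MeetZero : Nonempty (support u ∩ support v) → ¬ MeetZero u v
  meets⇒¬MeetZero {u} {v} (x , x∈u∩v) meetZero =
    let (x∈u , x∈v) = x∈p∩q⁻ (support u) (support v) x∈u∩v
    in contradiction (meetZero (atom x) (chainBottom-≤B (⁅⁆⊆ x∈u)) (chainBottom-≤B (⁅⁆⊆ x∈v))) λ ()

  meets⇒Adj : u ≢ v → Zstar u → Zstar v → Nonempty (support u ∩ support v) → Adj u v
  meets⇒Adj u≢v u* v* meets = u≢v , u* , v* , meets⇒¬MeetZero meets

  disjoint⇒Dist2 : Zstar u → Zstar v → Empty (support u ∩ support v) → Dist u v 2
  disjoint⇒Dist2 {u} {v} u* v* disjoint with Zstar⇒Nonempty u* | Zstar⇒Nonempty v*
  ... | x , x∈u | y , y∈v = step u∼xy (step xy∼v (here v*)) , minimal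
    where
    xy : BlowUp n sz
    xy = let (z , z≢x , z≢y) = thirdPoint n≥3 x y in chainBottom (⁅ x ⁆ ∪ ⁅ y ⁆) (⁅⁆∪⁅⁆-nontrivial z≢x z≢y)
    x∈xy : x ∈ support xy
    x∈xy = x∈p∪q⁺ (inj₁ (x∈⁅x⁆ x))
    y∈xy : y ∈ support xy
    y∈xy = x∈p∪q⁺ (inj₂ (x∈⁅x⁆ y))
    u∼xy : Adj u xy
    u∼xy = meets⇒Adj (λ u≡xy → disjoint (y , x∈p∩q⁺ (subst (λ u → y ∈ support u) (sym u≡xy) y∈xy , y∈v)))
                     u* (Zstar⁺ (λ ()) (λ ())) (x , x∈p∩q⁺ (x∈u , x∈xy))
    xy∼v : Adj xy v
    xy∼v = meets⇒Adj (λ xy≡v → disjoint (x , x∈p∩q⁺ (x∈u , subst (λ v → x ∈ support v) xy≡v x∈xy)))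
                     (Zstar⁺ (λ ()) (λ ())) v* (y , x∈p∩q⁺ (y∈xy , y∈v))
    minimal : ∀ m → Walk u v m → 2 ≤ m
    minimal zero walk =
      contradiction (x , x∈p∩q⁺ (x∈u , subst (λ v → x ∈ support v) (Walk0⇒≡ walk) x∈u)) disjoint
    minimal (suc zero) walk = contradiction (Adj⇒meets (Walk1⇒Adj walk)) disjoint
    minimal (suc (suc _)) _ = s≤s (s≤s z≤n)

  -- Equality of vertices need not be decided: k ≤ 1 is decidable, and k ≰ 1 already forces u ≢ v.
  meets⇒Dist≤1 : Zstar u → Zstar v → Nonempty (support u ∩ support v) → Dist u v k → k ≤ 1
  meets⇒Dist≤1 {u} {k = k} u* v* meets (_ , minimal) = decidable-stable (k ≤? 1) λ k≰1 →
    let u≢v = λ u≡v → k≰1 (≤-trans (minimal 0 (subst (λ v → Walk u v 0) u≡v (here u*))) z≤n)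
    in k≰1 (minimal 1 (proj₁ (Adj⇒Dist1 (meets⇒Adj u≢v u* v* meets))))

  Dist≤2 : Zstar u → Zstar v → Dist u v k → k ≤ 2
  Dist≤2 {u} {v} u* v* dist with nonempty? (support u ∩ support v)
  ... | yes meets = m≤n⇒m≤1+n (meets⇒Dist≤1 u* v* meets dist)
  ... | no disjoint = proj₂ dist 2 (proj₁ (disjoint⇒Dist2 u* v* disjoint))

  disjoint⇒MaxDist : Zstar u → Zstar v → Empty (support u ∩ support v) → MaxDist u v
  disjoint⇒MaxDist u* v* disjoint _ (_ , _ , w* , _) k l v~w u~v =
    ≤-trans (Dist≤2 v* w* v~w) (proj₂ (disjoint⇒Dist2 u* v* disjoint) l (proj₁ u~v))

  sameSupport⇒MaxDist : Zstar u → Zstar v → u ≢ v → support u ≡ support v → MaxDist u v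
  sameSupport⇒MaxDist u* v* u≢v same w adj@(_ , _ , w* , _) k l v~w u~v =
    ≤-trans (meets⇒Dist≤1 v* w* v∩w-Nonempty v~w) (Dist≥1 u≢v u~v)
    where v∩w-Nonempty = subst (λ a → Nonempty (a ∩ support w)) same (Adj⇒meets adj)

  overlap⇒¬MaxDist : Zstar u → Zstar v → x ∈ support u → x ∉ support v →
                     Nonempty (support u ∩ support v) → ¬ MaxDist u v
  overlap⇒¬MaxDist {u} {v} {x} u* v* x∈u x∉v (y , y∈u∩v) maxDist =
    contradiction (maxDist (atom x) u∼x 2 1 (disjoint⇒Dist2 v* x* v∩x-Empty) (Adj⇒Dist1 u∼v)) λ { (s≤s ()) }
    where
    y∈u = proj₁ (x∈p∩q⁻ (support u) (support v) y∈u∩v)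
    y∈v = proj₂ (x∈p∩q⁻ (support u) (support v) y∈u∩v)
    x* : Zstar (atom x)
    x* = Zstar⁺ (λ ()) (λ ())
    u∼x : Adj u (atom x)
    u∼x = meets⇒Adj u≢x u* x* (x , x∈p∩q⁺ (x∈u , x∈⁅x⁆ x))
      where
      u≢x : u ≢ atom x
      u≢x u≡x = x∉v (subst (_∈ support v) (x∈⁅y⁆⇒x≡y x (subst (λ u → y ∈ support u) u≡x y∈u)) y∈v)
    u∼v : Adj u v
    u∼v = meets⇒Adj (λ u≡v → x∉v (subst (λ u → x ∈ support u) u≡v x∈u)) u* v* (y , y∈u∩v)
    v∩x-Empty : Empty (support v ∩ ⁅ x ⁆)
    v∩x-Empty (z , z∈v∩x) =
      let (z∈v , z∈x) = x∈p∩q⁻ (support v) ⁅ x ⁆ z∈v∩x in x∉v (subst (_∈ support v) (x∈⁅y⁆⇒x≡y x z∈x) z∈v)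

  disjoint⇒MMD : Zstar u → Zstar v → Empty (support u ∩ support v) → MMD u v
  disjoint⇒MMD u* v* disjoint =
    u* , v* , disjoint⇒MaxDist u* v* disjoint , disjoint⇒MaxDist v* u* (disjoint ∘ ∩-comm-Nonempty)

  sameSupport⇒MMD : Zstar u → Zstar v → u ≢ v → support u ≡ support v → MMD u v
  sameSupport⇒MMD u* v* u≢v same =
    u* , v* , sameSupport⇒MaxDist u* v* u≢v same , sameSupport⇒MaxDist v* u* (≢-sym u≢v) (sym same)

  MMD⇒sameSupport⊎disjoint : MMD u v → support u ≡ support v ⊎ Empty (support u ∩ support v)
  MMD⇒sameSupport⊎disjoint {u} {v} (u* , v* , u→v , v→u) with nonempty? (support u ∩ support v)
  ... | no disjoint = inj₂ disjoint
  ... | yes meets with ≡-dec _≟ᵇ_ (support u) (support v)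
  ...   | yes same = inj₁ same
  ...   | no differ with ≢⇒distinguishing _ _ differ
  ...     | x , inj₁ (x∈u , x∉v) = contradiction u→v (overlap⇒¬MaxDist u* v* x∈u x∉v meets)
  ...     | x , inj₂ (x∈v , x∉u) = contradiction v→u (overlap⇒¬MaxDist v* u* x∈v x∉u (∩-comm-Nonempty meets))

  Zstar⇒InBoundary : Zstar u → InBoundary u
  Zstar⇒InBoundary {bot} (u≢bot , _) = contradiction refl u≢bot
  Zstar⇒InBoundary {top} u* = contradiction refl (Zstar⇒≢top u*)
  Zstar⇒InBoundary {mid a p _} u* = complement , disjoint⇒MMD u* (Zstar⁺ (λ ()) (λ ())) (∩∁-Empty a)
    where complement = chainBottom (∁ a) (∁-nontrivial a p)

module _ {m : ℕ} {sz : Subset (suc m) → ℕ} (n≥3 : 3 ≤ suc m) where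

  private variable
    u v : BlowUp (suc m) sz

  sameClass⇒MMD : Zstar u → Zstar v → u ≢ v →
                  complementClass (support u) ≡ complementClass (support v) → MMD u v
  sameClass⇒MMD {u} u* v* u≢v sameClass with complementClass-≡ sameClass
  ... | inj₁ same = sameSupport⇒MMD n≥3 u* v* u≢v same
  ... | inj₂ ∁u≡v =
    disjoint⇒MMD n≥3 u* v* (subst (λ b → Empty (support u ∩ b)) ∁u≡v (∩∁-Empty (support u)))

  independentSR-length≤ : ∀ S → IndependentSR {sz = sz} S → length S ≤ 2 ^ m ∸ 1
  independentSR-length≤ S (S! , S∂ , S-nonadjacent) = ∸-monoˡ-≤ 1 (begin
    suc (length S)              ≡⟨ cong suc (length-map class S) ⟨
    length (⊥ ∷ map class S)    ≤⟨ unique-⊆⇒length≤ classes! (λ {a} _ → ∈-allSubsets a) ⟩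
    length (allSubsets m)       ≡⟨ length-allSubsets m ⟩
    2 ^ m                       ∎)
    where
    open ≤-Reasoning
    class = complementClass ∘ support
    S* = All.map (λ (_ , u* , _) → u*) S∂
    classes! : Unique (⊥ ∷ map class S)
    classes! = All.map⁺ (All.map (λ {u} u* → ≢-sym (complementClass≢⊥ (support u) (Zstar⇒nontrivial u*))) S*)
             ∷ AllPairs.map⁺ (AllPairs-mapWithin distinctClasses S* (AllPairs.zip (S! , S-nonadjacent)))
      where
      distinctClasses : Zstar u → Zstar v → u ≢ v × ¬ AdjSR u v → class u ≢ class v
      distinctClasses u* v* (u≢v , ¬u~v) = ¬u~v ∘ (u≢v ,_) ∘ sameClass⇒MMD u* v* u≢v

  bottomsContaining0 : List (BlowUp (suc m) sz)
  bottomsContaining0 = map (λ (t , p) → chainBottom (inside ∷ t) p) (nontrivialContaining0 m)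

  bottomsContaining0-independent : IndependentSR bottomsContaining0
  bottomsContaining0-independent =
      AllPairs.map⁺ (AllPairs.map (λ t≢s → t≢s ∘ ∷-injectiveʳ ∘ cong support) (nontrivialContaining0-unique m))
    , All.map⁺ (All.universal (λ _ → Zstar⇒InBoundary n≥3 (Zstar⁺ (λ ()) (λ ()))) _)
    , AllPairs.map⁺ (AllPairs.map nonadjacent (nontrivialContaining0-unique m))
    where
    nonadjacent : ∀ {t s : Subset m} {p q} → t ≢ s →
                  ¬ AdjSR {sz = sz} (chainBottom (inside ∷ t) p) (chainBottom (inside ∷ s) q)
    nonadjacent t≢s (_ , mmd) with MMD⇒sameSupport⊎disjoint n≥3 mmd
    ... | inj₁ same = t≢s (∷-injectiveʳ same)
    ... | inj₂ disjoint = disjoint (0F , here)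

  length-bottomsContaining0 : length bottomsContaining0 ≡ 2 ^ m ∸ 1
  length-bottomsContaining0 = trans (length-map _ (nontrivialContaining0 m)) (length-nontrivialContaining0 m)

lemma3p19 : (n : ℕ) → 3 ≤ n → (sz : Subset n → ℕ) →
    IndependenceNumberSR {n} {sz} (2 ^ (n ∸ 1) ∸ 1)
lemma3p19 zero () _
lemma3p19 (suc m) n≥3 sz =
    (bottomsContaining0 n≥3 , bottomsContaining0-independent n≥3 , length-bottomsContaining0 n≥3)
  , independentSR-length≤ n≥3
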